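{- Let $G$ be a signed graph which contains the complete signed graph with loops $B_n$ as a subgraph, and let $k$ be a positive integer. For two proper $k$-colorings $\gamma_1,\gamma_2$ of $B_n$, let $C_1$, $C_2$ be the sets of proper $k$-colorings of $G$ whose restrictions to the vertex set of $B_n$ are equal to $\gamma_1$, $\gamma_2$ respectively. Then $|C_1|=|C_2|$.
   Context: A signed graph $G=(G^+,G^-,L_G)$ consists of simple graphs $G^+=(V_G,E_G^+)$, $G^-=(V_G,E_G^-)$ on a common finite vertex set and a loop set $L_G\subseteq V_G$. $F$ is a subgraph of $G$ if $F^+,F^-$ are subgraphs of $G^+,G^-$ on a common vertex set $V_F\subseteq V_G$ and $L_F\subseteq L_G$. $B_n=(K_n,K_n,V)$ is the signed graph on $n$ vertices $V$ in which every pair of distinct vertices is joined by both a positive and a negative edge and every vertex has a loop. With $\Lambda_k=\{0,\pm1,\dots,\pm k\}$, a proper $k$-coloring of $G$ is a map $\gamma:V_G\to\Lambda_k$ with $\gamma(u)\ne\gamma(v)$ for $\{u,v\}\in E_G^+$, $\gamma(u)\ne-\gamma(v)$ for $\{u,v\}\in E_G^-$, and $\gamma(v)\ne0$ for $v\in L_G$. -}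

module Defs where

open import Data.Bool using (Bool; true; false)
import Data.Bool.Properties as BoolP
open import Data.Nat using (ℕ; zero; suc; _≤_; _≤?_)
open import Data.Integer using (ℤ; +_; -[1+_]; -_; ∣_∣; 0ℤ)
import Data.Integer.Properties as ℤP
open import Data.Fin using (Fin)
import Data.Fin
open import Data.Fin.Properties using (all?)
open import Data.Product using (_×_; _,_)
open import Data.List using (List; []; _∷_; map; concatMap; upTo; _++_; length; filter)
import Data.Vec.Functional as VF
open import Function using (_∘_; Injective)
open import Relation.Binary.PropositionalEquality using (_≡_; _≢_)
open import Relation.Nullary using (Dec; yes; no; ¬?)
import Data.Empty
import Relation.Binary.PropositionalEquality
open import Relation.Nullary.Decidable using (_×-dec_; _→-dec_)

record SignedGraph (m : ℕ) : Set where
  field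
    pos     : Fin m → Fin m → Bool
    neg     : Fin m → Fin m → Bool
    loop    : Fin m → Bool
    pos-sym : ∀ u v → pos u v ≡ pos v u
    neg-sym : ∀ u v → neg u v ≡ neg v u
    pos-irr : ∀ v → pos v v ≡ false
    neg-irr : ∀ v → neg v v ≡ false
open SignedGraph public

distinct : ∀ {n} → Fin n → Fin n → Bool
distinct u v with u Data.Fin.≟ v
... | yes _ = false
... | no _  = true

private
  distinct-sym : ∀ {n} (u v : Fin n) → distinct u v ≡ distinct v u
  distinct-sym u v with u Data.Fin.≟ v | v Data.Fin.≟ u
  ... | yes _ | yes _ = _≡_.refl
  ... | yes p | no q = Data.Empty.⊥-elim (q (Relation.Binary.PropositionalEquality.sym p))
  ... | no q | yes p = Data.Empty.⊥-elim (q (Relation.Binary.PropositionalEquality.sym p))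
  ... | no _ | no _ = _≡_.refl

  distinct-irr : ∀ {n} (v : Fin n) → distinct v v ≡ false
  distinct-irr v with v Data.Fin.≟ v
  ... | yes _ = _≡_.refl
  ... | no q = Data.Empty.⊥-elim (q _≡_.refl)

B : (n : ℕ) → SignedGraph n
B n = record
  { pos = distinct ; neg = distinct ; loop = λ _ → true
  ; pos-sym = distinct-sym ; neg-sym = distinct-sym
  ; pos-irr = distinct-irr ; neg-irr = distinct-irr }

IsSubgraph : ∀ {n m} → SignedGraph n → SignedGraph m → (Fin n → Fin m) → Set
IsSubgraph F G ι =
  Injective _≡_ _≡_ ι
  × (∀ u v → pos F u v ≡ true → pos G (ι u) (ι v) ≡ true)
  × (∀ u v → neg F u v ≡ true → neg G (ι u) (ι v) ≡ true)
  × (∀ v → loop F v ≡ true → loop G (ι v) ≡ true)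

-- Λ_k = {0, ±1, ..., ±k} ⊆ ℤ ; a color is an integer z with ∣ z ∣ ≤ k.
-- Proper k-coloring of G (colorings are maps V_G → ℤ with values in Λ_k).
ProperColoring : ∀ {m} → SignedGraph m → ℕ → (Fin m → ℤ) → Set
ProperColoring G k γ =
  (∀ v → ∣ γ v ∣ ≤ k)
  × (∀ u v → pos G u v ≡ true → γ u ≢ γ v)
  × (∀ u v → neg G u v ≡ true → γ u ≢ - γ v)
  × (∀ v → loop G v ≡ true → γ v ≢ 0ℤ)

properColoring? : ∀ {m} (G : SignedGraph m) (k : ℕ) (γ : Fin m → ℤ) → Dec (ProperColoring G k γ)
properColoring? G k γ =
  all? (λ v → ∣ γ v ∣ ≤? k)
  ×-dec all? (λ u → all? (λ v → (pos G u v BoolP.≟ true) →-dec ¬? (γ u ℤP.≟ γ v)))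
  ×-dec all? (λ u → all? (λ v → (neg G u v BoolP.≟ true) →-dec ¬? (γ u ℤP.≟ - γ v)))
  ×-dec all? (λ v → (loop G v BoolP.≟ true) →-dec ¬? (γ v ℤP.≟ 0ℤ))

RestrictsTo : ∀ {n m} → (Fin n → Fin m) → (Fin m → ℤ) → (Fin n → ℤ) → Set
RestrictsTo ι γ γ₀ = ∀ i → γ (ι i) ≡ γ₀ i

restrictsTo? : ∀ {n m} (ι : Fin n → Fin m) (γ : Fin m → ℤ) (γ₀ : Fin n → ℤ) → Dec (RestrictsTo ι γ γ₀)
restrictsTo? ι γ γ₀ = all? (λ i → γ (ι i) ℤP.≟ γ₀ i)

Λlist : ℕ → List ℤ
Λlist k = map +_ (upTo (suc k)) ++ map -[1+_] (upTo k)

-- All maps Fin m → A with values in a given list (each map listed once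
-- when the list has no duplicates).
allMaps : ∀ {A : Set} (m : ℕ) → List A → List (Fin m → A)
allMaps zero    xs = (λ ()) ∷ []
allMaps (suc m) xs = concatMap (λ a → map (a VF.∷_) (allMaps m xs)) xs

numExtensions : ∀ {n m} (G : SignedGraph m) (k : ℕ) (ι : Fin n → Fin m) (γ₀ : Fin n → ℤ) → ℕ
numExtensions {m = m} G k ι γ₀ =
  length (filter (λ γ → properColoring? G k γ ×-dec restrictsTo? ι γ γ₀) (allMaps m (Λlist k)))

module Submission where

-- Call τ : ℤ → ℤ a signed symmetry of Λ_k if it is an
-- involution, commutes with negation and maps Λ_k into itself.  Composing a
-- colouring with τ preserves every constraint of a proper colouring (edges of
-- both signs and loops), so γ ↦ τ ∘ γ is a bijection between the proper
-- k-colourings of G extending γ₀ and those extending τ ∘ γ₀; hence both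
-- extension counts agree.
--   For nonzero colours c, d ∈ Λ_k the signed swap (c ↔ d, -c ↔ -d, all
-- other colours fixed) is a signed symmetry.  A proper colouring of B_n uses
-- nonzero colours, pairwise distinct up to sign, so starting from γ₁ we can
-- apply signed swaps vertex by vertex, each one fixing the colours of the
-- vertices already matched with γ₂; after n swaps we reach a colouring equal
-- to γ₂ pointwise.  Since no swap changes the count, the theorem follows.

open import Defs
open import Data.Nat using (ℕ; _≤_)
open import Data.Integer using (ℤ)
open import Data.Fin using (Fin)
open import Relation.Binary.PropositionalEquality using (_≡_)

import Data.Nat as ℕ
import Data.Nat.Properties as ℕP
open import Data.Integer using (+_; -[1+_]; -_; ∣_∣; 0ℤ)
open import Data.Integer.Properties using (_≟_; neg-involutive; neg-injective; ∣-i∣≡∣i∣)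
import Data.Fin as Fin
import Data.Fin.Properties as FinP
open import Data.Product using (Σ; _×_; _,_; proj₁; proj₂)
open import Data.Sum using (inj₁; inj₂)
open import Data.List using (List; []; _∷_; map; length; filter; upTo)
open import Data.List.Relation.Binary.Pointwise using (Pointwise; []; _∷_; Pointwise-length; filter⁺; concat⁺; map⁺)
import Data.List.Relation.Binary.Pointwise as Pointwise
open import Data.List.Relation.Binary.Permutation.Propositional.Properties using (filter-↭; ↭-length)
open import Data.List.Relation.Binary.BagAndSetEquality using (bag; _∼[_]_; >>=-cong; map-cong; ∼bag⇒↭)
open import Data.List.Membership.Propositional using (_∈_)
open import Data.List.Membership.Propositional.Properties using (∈-++⁻; ∈-++⁺ˡ; ∈-++⁺ʳ; ∈-map⁺; ∈-map⁻; ∈-upTo⁺; ∈-upTo⁻)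
open import Data.List.Membership.Propositional.Properties.WithK using (unique∧set⇒bag)
open import Data.List.Relation.Unary.Unique.Propositional using (Unique)
import Data.List.Relation.Unary.Unique.Propositional.Properties as Unique
import Data.Vec.Functional as VF
open import Function using (_∘_)
open import Function.Bundles using (mk⇔)
open import Function.Related.Propositional using (K-refl)
open import Relation.Binary.PropositionalEquality using (_≢_; refl; sym; trans; cong; subst; module ≡-Reasoning)
open import Relation.Nullary using (Dec; yes; no; ¬_)
open import Relation.Nullary.Decidable using (_×-dec_)
open import Relation.Unary using (Decidable)
open import Data.Empty using (⊥-elim)
open import Data.Bool using (true)

filter-length-transfer : ∀ {A B : Set} {R : A → B → Set} {P : A → Set} {Q : B → Set}
  (P? : Decidable P) (Q? : Decidable Q)
  → (∀ {x y} → R x y → P x → Q y) → (∀ {x y} → R x y → Q y → P x)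
  → ∀ {xs ys} → Pointwise R xs ys → length (filter P? xs) ≡ length (filter Q? ys)
filter-length-transfer P? Q? P⇒Q Q⇒P rel = Pointwise-length (filter⁺ P? Q? P⇒Q Q⇒P rel)

allMaps-bag : ∀ {A : Set} m {xs ys : List A} → xs ∼[ bag ] ys → allMaps m xs ∼[ bag ] allMaps m ys
allMaps-bag ℕ.zero    xs≈ys = K-refl
allMaps-bag (ℕ.suc m) xs≈ys = >>=-cong xs≈ys (λ a → map-cong (λ _ → refl) (allMaps-bag m xs≈ys))

Recolours : ∀ {m} → (ℤ → ℤ) → (Fin m → ℤ) → (Fin m → ℤ) → Set
Recolours τ γ γ' = ∀ i → γ' i ≡ τ (γ i)

allMaps-recolour : ∀ (τ : ℤ → ℤ) m (xs : List ℤ)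
  → Pointwise (Recolours τ) (allMaps m xs) (allMaps m (map τ xs))
allMaps-recolour τ ℕ.zero    xs = (λ ()) ∷ []
allMaps-recolour τ (ℕ.suc m) xs = concat⁺ (map⁺ _ _ (extendAll xs))
  where
  extend : ∀ a {γ γ'} → Recolours τ γ γ' → Recolours τ (a VF.∷ γ) (τ a VF.∷ γ')
  extend a r Fin.zero    = refl
  extend a r (Fin.suc i) = r i

  extendAll : ∀ ys → Pointwise (λ a b → Pointwise (Recolours τ) (map (a VF.∷_) (allMaps m xs))
                                                               (map (b VF.∷_) (allMaps m (map τ xs))))
                               ys (map τ ys)
  extendAll []       = []
  extendAll (a ∷ ys) = map⁺ _ _ (Pointwise.map (extend a) (allMaps-recolour τ m xs)) ∷ extendAll ys

∈Λ⇒bounded : ∀ k {x} → x ∈ Λlist k → ∣ x ∣ ≤ k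
∈Λ⇒bounded k x∈ with ∈-++⁻ (map +_ (upTo (ℕ.suc k))) x∈
... | inj₁ x∈⁺ with _ , n∈ , refl ← ∈-map⁻ +_ x∈⁺ = ℕP.≤-pred (∈-upTo⁻ n∈)
... | inj₂ x∈⁻ with _ , n∈ , refl ← ∈-map⁻ -[1+_] x∈⁻ = ∈-upTo⁻ n∈

bounded⇒∈Λ : ∀ k x → ∣ x ∣ ≤ k → x ∈ Λlist k
bounded⇒∈Λ k (+ n)    n≤k = ∈-++⁺ˡ (∈-map⁺ +_ (∈-upTo⁺ (ℕ.s≤s n≤k)))
bounded⇒∈Λ k -[1+ n ] n<k = ∈-++⁺ʳ (map +_ (upTo (ℕ.suc k))) (∈-map⁺ -[1+_] (∈-upTo⁺ n<k))

Λ-unique : ∀ k → Unique (Λlist k)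
Λ-unique k = Unique.++⁺ (Unique.map⁺ (λ { refl → refl }) (Unique.upTo⁺ (ℕ.suc k)))
                        (Unique.map⁺ (λ { refl → refl }) (Unique.upTo⁺ k))
                        signs-differ
  where
  signs-differ : ∀ {x} → ¬ (x ∈ map +_ (upTo (ℕ.suc k)) × x ∈ map -[1+_] (upTo k))
  signs-differ (x∈⁺ , x∈⁻) with ∈-map⁻ +_ x∈⁺ | ∈-map⁻ -[1+_] x∈⁻
  ... | _ , _ , refl | _ , _ , ()

self-negating⇒zero : ∀ {x} → x ≡ - x → x ≡ 0ℤ
self-negating⇒zero {+ ℕ.zero} _ = refl
self-negating⇒zero {+ ℕ.suc n} ()
self-negating⇒zero { -[1+ n ]} ()

record SignedSymmetry (k : ℕ) (τ : ℤ → ℤ) : Set where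
  field
    involutive : ∀ x → τ (τ x) ≡ x
    odd        : ∀ x → τ (- x) ≡ - τ x
    bounded    : ∀ x → ∣ x ∣ ≤ k → ∣ τ x ∣ ≤ k

module _ {k : ℕ} {τ : ℤ → ℤ} (σ : SignedSymmetry k τ) where
  open SignedSymmetry σ

  injective : ∀ {x y} → τ x ≡ τ y → x ≡ y
  injective {x} {y} τx≡τy = begin
    x         ≡⟨ involutive x ⟨
    τ (τ x)   ≡⟨ cong τ τx≡τy ⟩
    τ (τ y)   ≡⟨ involutive y ⟩
    y         ∎
    where open ≡-Reasoning

  -- τ 0 = τ (- 0) = - τ 0.
  fixes-zero : τ 0ℤ ≡ 0ℤ
  fixes-zero = self-negating⇒zero (odd 0ℤ)

  -- τ permutes Λ_k: it is injective and maps Λ_k onto itself.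
  permutes-Λ : map τ (Λlist k) ∼[ bag ] Λlist k
  permutes-Λ = unique∧set⇒bag (Unique.map⁺ injective (Λ-unique k)) (Λ-unique k)
                 (mk⇔ image⊆Λ Λ⊆image)
    where
    image⊆Λ : ∀ {x} → x ∈ map τ (Λlist k) → x ∈ Λlist k
    image⊆Λ x∈ with y , y∈ , refl ← ∈-map⁻ τ x∈ = bounded⇒∈Λ k (τ y) (bounded y (∈Λ⇒bounded k y∈))
    Λ⊆image : ∀ {x} → x ∈ Λlist k → x ∈ map τ (Λlist k)
    Λ⊆image {x} x∈ = subst (_∈ map τ (Λlist k)) (involutive x)
                       (∈-map⁺ τ (bounded⇒∈Λ k (τ x) (bounded x (∈Λ⇒bounded k x∈))))

  recolour-back : ∀ {m} {γ γ' : Fin m → ℤ} → Recolours τ γ γ' → Recolours τ γ' γ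
  recolour-back {γ = γ} r i = trans (sym (involutive (γ i))) (cong τ (sym (r i)))

  recolour-proper : ∀ {m} (G : SignedGraph m) {γ γ'} → Recolours τ γ γ'
    → ProperColoring G k γ → ProperColoring G k γ'
  recolour-proper G {γ} {γ'} r (in-Λ , pos-ok , neg-ok , loop-ok) =
      (λ v → subst (λ z → ∣ z ∣ ≤ k) (sym (r v)) (bounded (γ v) (in-Λ v)))
    , (λ u v e γ'u≡γ'v → pos-ok u v e (injective (begin
        τ (γ u)    ≡⟨ r u ⟨
        γ' u       ≡⟨ γ'u≡γ'v ⟩
        γ' v       ≡⟨ r v ⟩
        τ (γ v)    ∎)))
    , (λ u v e γ'u≡-γ'v → neg-ok u v e (injective (begin
        τ (γ u)    ≡⟨ r u ⟨
        γ' u       ≡⟨ γ'u≡-γ'v ⟩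
        - γ' v     ≡⟨ cong -_ (r v) ⟩
        - τ (γ v)  ≡⟨ odd (γ v) ⟨
        τ (- γ v)  ∎)))
    , (λ v l γ'v≡0 → loop-ok v l (injective (begin
        τ (γ v)    ≡⟨ r v ⟨
        γ' v       ≡⟨ γ'v≡0 ⟩
        0ℤ         ≡⟨ fixes-zero ⟨
        τ 0ℤ       ∎)))
    where open ≡-Reasoning

  recolour-restriction : ∀ {n m} (ι : Fin n → Fin m) {γ γ' γ₀ γ₀'}
    → Recolours τ γ γ' → Recolours τ γ₀ γ₀' → RestrictsTo ι γ γ₀ → RestrictsTo ι γ' γ₀'
  recolour-restriction ι r r₀ γ|ι≡γ₀ i =
    trans (r (ι i)) (trans (cong τ (γ|ι≡γ₀ i)) (sym (r₀ i)))

  recolour-extensions : ∀ {n m} (G : SignedGraph m) (ι : Fin n → Fin m) {γ₀ γ₀'}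
    → Recolours τ γ₀ γ₀' → numExtensions G k ι γ₀ ≡ numExtensions G k ι γ₀'
  recolour-extensions {m = m} G ι {γ₀} {γ₀'} r₀ = begin
    numExtensions G k ι γ₀
      ≡⟨ filter-length-transfer (Extends? γ₀) (Extends? γ₀') forth back (allMaps-recolour τ m (Λlist k)) ⟩
    length (filter (Extends? γ₀') (allMaps m (map τ (Λlist k))))
      ≡⟨ ↭-length (filter-↭ (Extends? γ₀') (∼bag⇒↭ (allMaps-bag m permutes-Λ))) ⟩
    numExtensions G k ι γ₀'
      ∎
    where
    open ≡-Reasoning
    Extends? : ∀ δ (γ : Fin m → ℤ) → Dec (ProperColoring G k γ × RestrictsTo ι γ δ)
    Extends? δ γ = properColoring? G k γ ×-dec restrictsTo? ι γ δ
    forth : ∀ {γ γ'} → Recolours τ γ γ'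
      → ProperColoring G k γ × RestrictsTo ι γ γ₀ → ProperColoring G k γ' × RestrictsTo ι γ' γ₀'
    forth r (proper , restricts) = recolour-proper G r proper , recolour-restriction ι r r₀ restricts
    back : ∀ {γ γ'} → Recolours τ γ γ'
      → ProperColoring G k γ' × RestrictsTo ι γ' γ₀' → ProperColoring G k γ × RestrictsTo ι γ γ₀
    back r (proper , restricts) =
      recolour-proper G (recolour-back r) proper , recolour-restriction ι (recolour-back r) (recolour-back r₀) restricts

-- The identity is a signed symmetry; hence the extension count only depends
-- on the precolouring up to pointwise equality.
identity-symmetry : ∀ k → SignedSymmetry k (λ x → x)
identity-symmetry k = record { involutive = λ _ → refl ; odd = λ _ → refl ; bounded = λ _ b → b }

numExtensions-cong : ∀ {n m} (G : SignedGraph m) k (ι : Fin n → Fin m) {γ₀ γ₀' : Fin n → ℤ}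
  → (∀ i → γ₀ i ≡ γ₀' i) → numExtensions G k ι γ₀ ≡ numExtensions G k ι γ₀'
numExtensions-cong G k ι γ₀≗γ₀' = recolour-extensions (identity-symmetry k) G ι (λ i → sym (γ₀≗γ₀' i))

infix 4 _∉±_
_∉±_ : ℤ → ℤ → Set
x ∉± c = x ≢ c × x ≢ - c

neg-swap : ∀ {x y} → - x ≡ y → x ≡ - y
neg-swap {x} -x≡y = trans (sym (neg-involutive x)) (cong -_ -x≡y)

∉±-neg : ∀ {x c} → x ∉± c → - x ∉± c
∉±-neg (x≢c , x≢-c) = (λ -x≡c → x≢-c (neg-swap -x≡c)) , (λ -x≡-c → x≢c (neg-injective -x≡-c))

signedSwap : ℤ → ℤ → ℤ → ℤ
signedSwap c d x with x ≟ c
... | yes _ = d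
... | no _ with x ≟ - c
...   | yes _ = - d
...   | no _ with x ≟ d
...     | yes _ = c
...     | no _ with x ≟ - d
...       | yes _ = - c
...       | no _ = x

module SignedSwap (c d : ℤ) (c≢0 : c ≢ 0ℤ) (d≢0 : d ≢ 0ℤ) where
  s : ℤ → ℤ
  s = signedSwap c d

  c≢-c : c ≢ - c
  c≢-c = c≢0 ∘ self-negating⇒zero

  d≢-d : d ≢ - d
  d≢-d = d≢0 ∘ self-negating⇒zero

  s-c : s c ≡ d
  s-c with c ≟ c
  ... | yes _    = refl
  ... | no c≢c   = ⊥-elim (c≢c refl)

  s-neg-c : s (- c) ≡ - d
  s-neg-c with - c ≟ c
  ... | yes -c≡c = ⊥-elim (c≢-c (sym -c≡c))
  ... | no _ with - c ≟ - c
  ...   | yes _  = refl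
  ...   | no ≢-refl = ⊥-elim (≢-refl refl)

  s-d : s d ≡ c
  s-d with d ≟ c
  ... | yes d≡c  = d≡c
  ... | no _ with d ≟ - c
  ...   | yes d≡-c = sym (neg-swap (sym d≡-c))
  ...   | no _ with d ≟ d
  ...     | yes _  = refl
  ...     | no ≢-refl = ⊥-elim (≢-refl refl)

  s-neg-d : s (- d) ≡ - c
  s-neg-d with - d ≟ c
  ... | yes -d≡c = neg-swap -d≡c
  ... | no _ with - d ≟ - c
  ...   | yes -d≡-c = -d≡-c
  ...   | no _ with - d ≟ d
  ...     | yes -d≡d = ⊥-elim (d≢-d (sym -d≡d))
  ...     | no _ with - d ≟ - d
  ...       | yes _  = refl
  ...       | no ≢-refl = ⊥-elim (≢-refl refl)

  s-fix : ∀ {x} → x ∉± c → x ∉± d → s x ≡ x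
  s-fix {x} (x≢c , x≢-c) (x≢d , x≢-d) with x ≟ c
  ... | yes x≡c = ⊥-elim (x≢c x≡c)
  ... | no _ with x ≟ - c
  ...   | yes x≡-c = ⊥-elim (x≢-c x≡-c)
  ...   | no _ with x ≟ d
  ...     | yes x≡d = ⊥-elim (x≢d x≡d)
  ...     | no _ with x ≟ - d
  ...       | yes x≡-d = ⊥-elim (x≢-d x≡-d)
  ...       | no _ = refl

  data Position (x : ℤ) : Set where
    at-c     : x ≡ c → Position x
    at-neg-c : x ≡ - c → Position x
    at-d     : x ≡ d → Position x
    at-neg-d : x ≡ - d → Position x
    elsewhere : x ∉± c → x ∉± d → Position x

  position : ∀ x → Position x
  position x with x ≟ c | x ≟ - c | x ≟ d | x ≟ - d
  ... | yes x≡c | _        | _       | _        = at-c x≡c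
  ... | no _    | yes x≡-c | _       | _        = at-neg-c x≡-c
  ... | no _    | no _     | yes x≡d | _        = at-d x≡d
  ... | no _    | no _     | no _    | yes x≡-d = at-neg-d x≡-d
  ... | no x≢c  | no x≢-c  | no x≢d  | no x≢-d  = elsewhere (x≢c , x≢-c) (x≢d , x≢-d)

  involutive : ∀ x → s (s x) ≡ x
  involutive x with position x
  ... | at-c refl     = trans (cong s s-c) s-d
  ... | at-neg-c refl = trans (cong s s-neg-c) s-neg-d
  ... | at-d refl     = trans (cong s s-d) s-c
  ... | at-neg-d refl = trans (cong s s-neg-d) s-neg-c
  ... | elsewhere x∉±c x∉±d = trans (cong s (s-fix x∉±c x∉±d)) (s-fix x∉±c x∉±d)

  odd : ∀ x → s (- x) ≡ - s x
  odd x with position x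
  ... | at-c refl     = trans s-neg-c (cong -_ (sym s-c))
  ... | at-neg-c refl = trans (cong s (neg-involutive c)) (trans s-c (neg-swap (sym s-neg-c)))
  ... | at-d refl     = trans s-neg-d (cong -_ (sym s-d))
  ... | at-neg-d refl = trans (cong s (neg-involutive d)) (trans s-d (neg-swap (sym s-neg-d)))
  ... | elsewhere x∉±c x∉±d = trans (s-fix (∉±-neg x∉±c) (∉±-neg x∉±d)) (cong -_ (sym (s-fix x∉±c x∉±d)))

  symmetry : ∀ k → ∣ c ∣ ≤ k → ∣ d ∣ ≤ k → SignedSymmetry k s
  symmetry k ∣c∣≤k ∣d∣≤k = record { involutive = involutive ; odd = odd ; bounded = bounded }
    where
    within : ∀ x {y} → s x ≡ y → ∣ y ∣ ≤ k → ∣ s x ∣ ≤ k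
    within x sx≡y = subst (λ z → ∣ z ∣ ≤ k) (sym sx≡y)
    within-neg : ∀ x {y} → s x ≡ - y → ∣ y ∣ ≤ k → ∣ s x ∣ ≤ k
    within-neg x {y} sx≡-y ∣y∣≤k = within x sx≡-y (subst (_≤ k) (sym (∣-i∣≡∣i∣ y)) ∣y∣≤k)
    bounded : ∀ x → ∣ x ∣ ≤ k → ∣ s x ∣ ≤ k
    bounded x ∣x∣≤k with position x
    ... | at-c refl     = within c s-c ∣d∣≤k
    ... | at-neg-c refl = within-neg (- c) s-neg-c ∣d∣≤k
    ... | at-d refl     = within d s-d ∣c∣≤k
    ... | at-neg-d refl = within-neg (- d) s-neg-d ∣c∣≤k
    ... | elsewhere x∉±c x∉±d = within x (s-fix x∉±c x∉±d) ∣x∣≤k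

distinct-true : ∀ {n} {u v : Fin n} → u ≢ v → distinct u v ≡ true
distinct-true {u = u} {v} u≢v with u Fin.≟ v
... | yes u≡v = ⊥-elim (u≢v u≡v)
... | no _    = refl

-- In a proper colouring of B_n every colour is nonzero (loops) and colours
-- of distinct vertices differ up to sign (positive and negative edges).
module ProperColoringOfB {n k} {γ : Fin n → ℤ} (proper : ProperColoring (B n) k γ) where
  nonzero : ∀ v → γ v ≢ 0ℤ
  nonzero v = proj₂ (proj₂ (proj₂ proper)) v refl

  separated : ∀ {u v} → u ≢ v → γ u ∉± γ v
  separated {u} {v} u≢v = proj₁ (proj₂ proper) u v (distinct-true u≢v)
                        , proj₁ (proj₂ (proj₂ proper)) u v (distinct-true u≢v)

AgreeBelow : ∀ {n} → ℕ → (Fin n → ℤ) → (Fin n → ℤ) → Set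
AgreeBelow j γ γ' = ∀ i → Fin.toℕ i ℕ.< j → γ i ≡ γ' i

-- One alignment step: if proper colourings γ, γ₂ of B_n agree on the first
-- j < n vertices, the signed swap of γ v and γ₂ v at the next vertex v is a
-- signed symmetry after which they agree on the first j + 1 vertices; the
-- earlier vertices keep their colours because B_n separates them from v.
align-step : ∀ {n k} {γ γ₂ : Fin n → ℤ} → ProperColoring (B n) k γ → ProperColoring (B n) k γ₂
  → ∀ {j} → j ℕ.< n → AgreeBelow j γ γ₂
  → Σ (ℤ → ℤ) λ τ → SignedSymmetry k τ × AgreeBelow (ℕ.suc j) (τ ∘ γ) γ₂
align-step {n} {k} {γ} {γ₂} pγ pγ₂ {j} j<n agree =
  s , symmetry k (proj₁ pγ v) (proj₁ pγ₂ v) , agree-next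
  where
  module Pγ = ProperColoringOfB pγ
  module Pγ₂ = ProperColoringOfB pγ₂
  v : Fin n
  v = Fin.fromℕ< j<n
  open SignedSwap (γ v) (γ₂ v) (Pγ.nonzero v) (Pγ₂.nonzero v)

  agree-next : AgreeBelow (ℕ.suc j) (s ∘ γ) γ₂
  agree-next i i<1+j with ℕP.m<1+n⇒m<n∨m≡n i<1+j
  ... | inj₂ i≡j = subst (λ w → s (γ w) ≡ γ₂ w) (sym i≡v) s-c
    where i≡v = FinP.toℕ-injective (trans i≡j (sym (FinP.toℕ-fromℕ< j<n)))
  ... | inj₁ i<j = trans (s-fix (Pγ.separated i≢v) γi∉±γ₂v) (agree i i<j)
    where
    i≢v : i ≢ v
    i≢v i≡v = ℕP.<-irrefl (trans (cong Fin.toℕ i≡v) (FinP.toℕ-fromℕ< j<n)) i<j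
    γi∉±γ₂v : γ i ∉± γ₂ v
    γi∉±γ₂v = subst (_∉± γ₂ v) (sym (agree i i<j)) (Pγ₂.separated i≢v)

aligned-extensions : ∀ {n m} (G : SignedGraph m) (ι : Fin n → Fin m) k {γ₂ : Fin n → ℤ}
  → ProperColoring (B n) k γ₂
  → ∀ d j → d ℕ.+ j ≡ n → ∀ {γ} → ProperColoring (B n) k γ → AgreeBelow j γ γ₂
  → numExtensions G k ι γ ≡ numExtensions G k ι γ₂
aligned-extensions G ι k pγ₂ ℕ.zero j refl pγ agree =
  numExtensions-cong G k ι (λ i → agree i (FinP.toℕ<n i))
aligned-extensions G ι k pγ₂ (ℕ.suc d) j d+j≡n pγ agree
  with τ , σ , agree′ ← align-step pγ pγ₂ (subst (j ℕ.<_) d+j≡n (ℕP.m<n+m j ℕ.z<s)) agree =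
  trans (recolour-extensions σ G ι (λ _ → refl))
        (aligned-extensions G ι k pγ₂ d (ℕ.suc j) (trans (ℕP.+-suc d j) d+j≡n)
                            (recolour-proper σ (B _) (λ _ → refl) pγ) agree′)

-- Proposition 4.11.
proposition4p11 : ∀ {n m} (G : SignedGraph m) (ι : Fin n → Fin m)
    → IsSubgraph (B n) G ι
    → (k : ℕ) → 1 ≤ k
    → (γ₁ γ₂ : Fin n → ℤ)
    → ProperColoring (B n) k γ₁ → ProperColoring (B n) k γ₂
    → numExtensions G k ι γ₁ ≡ numExtensions G k ι γ₂
proposition4p11 {n} G ι _ k _ γ₁ γ₂ pγ₁ pγ₂ =
  aligned-extensions G ι k pγ₂ n 0 (ℕP.+-identityʳ n) pγ₁ (λ _ ())
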